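{- Let $1 \le t_1 < \cdots < t_k < n$ be integers and $G = G_n\langle t_1, \ldots, t_k\rangle$. Then $G$ is a circulant graph (i.e., its adjacency matrix is a circulant matrix) if and only if $t_{k+1-i} = n - t_i$ for each $i \in \{1, \ldots, k\}$.
   Context: For integers $1 \le t_1 < \cdots < t_k < n$, the Toeplitz graph $G_n\langle t_1, \ldots, t_k\rangle$ is the simple graph with vertex set $\{1, \ldots, n\}$ in which distinct vertices $i,j$ are adjacent iff $|i-j| \in \{t_1, \ldots, t_k\}$. A symmetric $(0,1)$ circulant matrix of order $n$ is a matrix $(c_{(i-j) \bmod n})_{i,j}$ with $c_0 = 0$ and $c_i = c_{n-i} \in \{0,1\}$ for $1 \le i \le \lfloor n/2\rfloor$. -}

module Defs where

open import Data.Nat using (ℕ; zero; suc; _+_; _∸_; _≤_; _<_; _/_; ∣_-_∣)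
open import Data.Nat.Properties using (_≟_; _<?_)
open import Data.Fin using (Fin; toℕ; opposite)
open import Data.Fin.Properties using (any?)
open import Data.Product using (_×_; ∃)
open import Data.Sum using (_⊎_)
open import Relation.Binary.PropositionalEquality using (_≡_; _≢_)
open import Relation.Nullary.Decidable using (does)
open import Data.Bool using (if_then_else_; _∧_; not)

-- Vertices 1..n are represented by Fin n (vertex v ↔ toℕ v + 1); differences
-- are unaffected by this shift.  The parameters t₁ < ⋯ < tₖ are a function
-- t : Fin k → ℕ (t_{l+1} = t l for l : Fin k).

ValidParams : (n k : ℕ) → (Fin k → ℕ) → Set
ValidParams n k t =
  (∀ (l : Fin k) → 1 ≤ t l) ×
  (∀ (a b : Fin k) → toℕ a < toℕ b → t a < t b) ×
  (∀ (l : Fin k) → t l < n)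

toeplitzAdj : (n k : ℕ) → (Fin k → ℕ) → Fin n → Fin n → ℕ
toeplitzAdj n k t i j =
  if not (does (toℕ i ≟ toℕ j)) ∧ does (any? (λ l → t l ≟ ∣ toℕ i - toℕ j ∣))
  then 1 else 0

diffMod : (n : ℕ) → Fin n → Fin n → ℕ
diffMod n i j = if does (toℕ i <? toℕ j) then (toℕ i + n) ∸ toℕ j else toℕ i ∸ toℕ j

IsSymCirculant : (n : ℕ) → (Fin n → Fin n → ℕ) → Set
IsSymCirculant n M = ∃ λ (c : ℕ → ℕ) →
  (c 0 ≡ 0) ×
  (∀ (i : ℕ) → 1 ≤ i → i ≤ n / 2 → (c i ≡ 0 ⊎ c i ≡ 1) × c i ≡ c (n ∸ i)) ×
  (∀ (i j : Fin n) → M i j ≡ c (diffMod n i j))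

IsCirculantToeplitz : (n k : ℕ) → (Fin k → ℕ) → Set
IsCirculantToeplitz n k t = IsSymCirculant n (toeplitzAdj n k t)

{-# OPTIONS --safe #-}
-- If G is circulant, its first row c is both the indicator of the parameter
-- set T and symmetric (c d = c (n − d), comparing the edges {0, d} and
-- {n − d, 0}), so T is closed under d ↦ n − d.  The two strictly increasing
-- enumerations i ↦ tᵢ and i ↦ n − t_{k+1−i} of T must then coincide.
-- Conversely, if T is mirror-symmetric, its indicator is a symmetric first
-- row, and |i − j| and (i − j) mod n are either equal or complementary.
module Submission where

open import Defs
open import Data.Nat using (ℕ; suc; _+_; _∸_; _≤_; _<_; z≤n; s≤s; _/_; ∣_-_∣)
open import Data.Nat.Properties
open import Data.Nat.DivMod using (m/n≤m)
open import Data.Fin using (Fin; toℕ; fromℕ<; opposite) renaming (zero to fzero; suc to fsuc)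
open import Data.Fin.Properties using (any?; toℕ<n; toℕ-fromℕ<; opposite-prop; opposite-involutive)
open import Data.Product using (_×_; _,_; ∃)
open import Data.Sum using (_⊎_; inj₁; inj₂)
open import Data.Bool using (Bool; if_then_else_; not; _∧_)
open import Data.Empty using (⊥-elim)
open import Function.Bundles using (_⇔_; mk⇔; Equivalence)
open import Relation.Nullary using (Dec; yes; no; ¬_)
open import Relation.Nullary.Decidable using (does; map′; does-≡; dec-true; dec-false)
open import Relation.Binary.PropositionalEquality using (_≡_; _≢_; refl; sym; trans; cong; subst; module ≡-Reasoning)
open ≡-Reasoning

private
  variable
    P Q : Set
    n k : ℕ

bit : Bool → ℕ
bit b = if b then 1 else 0

indicator : Dec P → ℕ
indicator p? = bit (does p?)

indicator-yes : (p? : Dec P) → P → indicator p? ≡ 1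
indicator-yes p? p = cong bit (dec-true p? p)

indicator-no : (p? : Dec P) → ¬ P → indicator p? ≡ 0
indicator-no p? ¬p = cong bit (dec-false p? ¬p)

indicator≡1⇒ : (p? : Dec P) → indicator p? ≡ 1 → P
indicator≡1⇒ (yes p) _ = p

indicator-01 : (p? : Dec P) → indicator p? ≡ 0 ⊎ indicator p? ≡ 1
indicator-01 (yes _) = inj₂ refl
indicator-01 (no _)  = inj₁ refl

indicator-cong : (p? : Dec P) (q? : Dec Q) → P ⇔ Q → indicator p? ≡ indicator q?
indicator-cong p? q? P⇔Q =
  -- does (map′ f g p?) reduces to does p?
  cong bit (does-≡ (map′ (Equivalence.to P⇔Q) (Equivalence.from P⇔Q) p?) q?)

StrictlyIncreasing : (Fin k → ℕ) → Set
StrictlyIncreasing {k} f = ∀ (a b : Fin k) → toℕ a < toℕ b → f a < f b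

InImage : (Fin k → ℕ) → ℕ → Set
InImage f d = ∃ λ l → f l ≡ d

strictlyIncreasing-tail : {f : Fin (suc k) → ℕ} →
  StrictlyIncreasing f → StrictlyIncreasing (λ a → f (fsuc a))
strictlyIncreasing-tail f↑ a b a<b = f↑ (fsuc a) (fsuc b) (s≤s a<b)

strictlyIncreasing-minimum : {f : Fin (suc k) → ℕ} → StrictlyIncreasing f → ∀ a → f fzero ≤ f a
strictlyIncreasing-minimum f↑ fzero    = ≤-refl
strictlyIncreasing-minimum f↑ (fsuc a) = <⇒≤ (f↑ fzero (fsuc a) (s≤s z≤n))

inImage-tail : {f g : Fin (suc k) → ℕ} → StrictlyIncreasing f → f fzero ≡ g fzero →
  ∀ a → InImage g (f (fsuc a)) → InImage (λ b → g (fsuc b)) (f (fsuc a))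
inImage-tail f↑ f₀≡g₀ a (fsuc b , e) = b , e
inImage-tail f↑ f₀≡g₀ a (fzero , e)  =
  ⊥-elim (<-irrefl (trans f₀≡g₀ e) (f↑ fzero (fsuc a) (s≤s z≤n)))

strictlyIncreasing-unique : {f g : Fin k → ℕ} → StrictlyIncreasing f → StrictlyIncreasing g →
  (∀ a → InImage g (f a)) → (∀ b → InImage f (g b)) → ∀ a → f a ≡ g a
strictlyIncreasing-unique {suc k} {f} {g} f↑ g↑ f⊆g g⊆f = λ where
    fzero    → f₀≡g₀
    (fsuc a) → strictlyIncreasing-unique
                 (strictlyIncreasing-tail f↑) (strictlyIncreasing-tail g↑)
                 (λ a → inImage-tail f↑ f₀≡g₀ a (f⊆g (fsuc a)))
                 (λ b → inImage-tail g↑ (sym f₀≡g₀) b (g⊆f (fsuc b))) a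
  where
  f₀≡g₀ : f fzero ≡ g fzero
  f₀≡g₀ with f⊆g fzero | g⊆f fzero
  ... | b , gb≡f₀ | a , fa≡g₀ =
    ≤-antisym (subst (f fzero ≤_) fa≡g₀ (strictlyIncreasing-minimum f↑ a))
              (subst (g fzero ≤_) gb≡f₀ (strictlyIncreasing-minimum g↑ b))

mirror : ℕ → (Fin k → ℕ) → Fin k → ℕ
mirror n t i = n ∸ t (opposite i)

MirrorSymmetric : ℕ → (Fin k → ℕ) → Set
MirrorSymmetric n t = ∀ i → t (opposite i) ≡ n ∸ t i

opposite-reverses-< : (a b : Fin k) → toℕ a < toℕ b → toℕ (opposite b) < toℕ (opposite a)
opposite-reverses-< {suc k} a b a<b rewrite opposite-prop a | opposite-prop b =
  ∸-monoʳ-< (s≤s a<b) (toℕ<n b)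

mirror-strictlyIncreasing : {t : Fin k → ℕ} → StrictlyIncreasing t → (∀ l → t l ≤ n) →
  StrictlyIncreasing (mirror n t)
mirror-strictlyIncreasing t↑ t≤n a b a<b =
  ∸-monoʳ-< (t↑ _ _ (opposite-reverses-< a b a<b)) (t≤n (opposite a))

complementClosed⇒mirrorSymmetric : {t : Fin k → ℕ} → StrictlyIncreasing t → (∀ l → t l ≤ n) →
  (∀ a → InImage t (n ∸ t a)) → MirrorSymmetric n t
complementClosed⇒mirrorSymmetric {n = n} {t} t↑ t≤n closed i = begin
  t (opposite i)                ≡⟨ t≡mirror (opposite i) ⟩
  n ∸ t (opposite (opposite i)) ≡⟨ cong (λ j → n ∸ t j) (opposite-involutive i) ⟩
  n ∸ t i                       ∎
  where
  t⊆mirror : ∀ a → InImage (mirror n t) (t a)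
  t⊆mirror a with closed a
  ... | m , tm≡n∸ta = opposite m , (begin
    n ∸ t (opposite (opposite m)) ≡⟨ cong (λ j → n ∸ t j) (opposite-involutive m) ⟩
    n ∸ t m                       ≡⟨ cong (n ∸_) tm≡n∸ta ⟩
    n ∸ (n ∸ t a)                 ≡⟨ m∸[m∸n]≡n (t≤n a) ⟩
    t a                           ∎)

  t≡mirror : ∀ a → t a ≡ mirror n t a
  t≡mirror = strictlyIncreasing-unique t↑ (mirror-strictlyIncreasing t↑ t≤n)
               t⊆mirror (λ b → closed (opposite b))

mirrorSymmetric⇒inImage-complement : ∀ {d} {t : Fin k → ℕ} → MirrorSymmetric n t → d ≤ n →
  InImage t d ⇔ InImage t (n ∸ d)
mirrorSymmetric⇒inImage-complement {n = n} {t = t} t-sym d≤n = mk⇔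
  (λ (l , tl≡d) → opposite l , trans (t-sym l) (cong (n ∸_) tl≡d))
  (λ (l , tl≡n∸d) → opposite l , trans (t-sym l) (trans (cong (n ∸_) tl≡n∸d) (m∸[m∸n]≡n d≤n)))

inImage? : (f : Fin k → ℕ) (d : ℕ) → Dec (InImage f d)
inImage? f d = any? (λ l → f l ≟ d)

firstRow : (Fin k → ℕ) → ℕ → ℕ
firstRow t d = indicator (inImage? t d)

firstRow-complement : ∀ {d} {t : Fin k → ℕ} → MirrorSymmetric n t → d ≤ n →
  firstRow t d ≡ firstRow t (n ∸ d)
firstRow-complement {n = n} {d = d} {t = t} t-sym d≤n =
  indicator-cong (inImage? t d) (inImage? t (n ∸ d)) (mirrorSymmetric⇒inImage-complement t-sym d≤n)

module _ {t : Fin k → ℕ} {i j : Fin n} where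

  private
    adjacencyGiven : Bool → ℕ
    adjacencyGiven i≡ᵇj = bit (not i≡ᵇj ∧ does (inImage? t ∣ toℕ i - toℕ j ∣))

  toeplitzAdj-diagonal : toℕ i ≡ toℕ j → toeplitzAdj n k t i j ≡ 0
  toeplitzAdj-diagonal i≡j = cong adjacencyGiven (dec-true (toℕ i ≟ toℕ j) i≡j)

  toeplitzAdj-offDiagonal : toℕ i ≢ toℕ j → toeplitzAdj n k t i j ≡ firstRow t ∣ toℕ i - toℕ j ∣
  toeplitzAdj-offDiagonal i≢j = cong adjacencyGiven (dec-false (toℕ i ≟ toℕ j) i≢j)

module _ {i j : Fin n} where

  private
    diffModGiven : Bool → ℕ
    diffModGiven i<ᵇj = if i<ᵇj then toℕ i + n ∸ toℕ j else toℕ i ∸ toℕ j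

  diffMod-< : toℕ i < toℕ j → diffMod n i j ≡ n ∸ ∣ toℕ i - toℕ j ∣
  diffMod-< i<j = begin
    diffMod n i j                         ≡⟨ cong diffModGiven (dec-true (toℕ i <? toℕ j) i<j) ⟩
    toℕ i + n ∸ toℕ j                     ≡⟨ cong (toℕ i + n ∸_) (m+[n∸m]≡n i≤j) ⟨
    toℕ i + n ∸ (toℕ i + (toℕ j ∸ toℕ i)) ≡⟨ [m+n]∸[m+o]≡n∸o (toℕ i) n (toℕ j ∸ toℕ i) ⟩
    n ∸ (toℕ j ∸ toℕ i)                   ≡⟨ cong (n ∸_) (m≤n⇒∣m-n∣≡n∸m i≤j) ⟨
    n ∸ ∣ toℕ i - toℕ j ∣                 ∎
    where i≤j = <⇒≤ i<j

  diffMod-≥ : ¬ toℕ i < toℕ j → diffMod n i j ≡ ∣ toℕ i - toℕ j ∣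
  diffMod-≥ i≮j = trans (cong diffModGiven (dec-false (toℕ i <? toℕ j) i≮j))
                        (sym (m≤n⇒∣n-m∣≡n∸m (≮⇒≥ i≮j)))

∣toℕ-toℕ∣≤ : (i j : Fin n) → ∣ toℕ i - toℕ j ∣ ≤ n
∣toℕ-toℕ∣≤ i j = ≤-trans (∣m-n∣≤m⊔n (toℕ i) (toℕ j)) (⊔-lub (<⇒≤ (toℕ<n i)) (<⇒≤ (toℕ<n j)))

circulant-diffMod-invariant : {M : Fin n → Fin n → ℕ} → IsSymCirculant n M →
  {i j i′ j′ : Fin n} → diffMod n i j ≡ diffMod n i′ j′ → M i j ≡ M i′ j′
circulant-diffMod-invariant (c , _ , _ , M≡c) {i} {j} {i′} {j′} e =
  trans (M≡c i j) (trans (cong c e) (sym (M≡c i′ j′)))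

circulant⇒firstRow-complement : ∀ {n k d} {t : Fin k → ℕ} → IsCirculantToeplitz n k t →
  0 < d → d < n → firstRow t (n ∸ d) ≡ firstRow t d
circulant⇒firstRow-complement {n@(suc _)} {k} {d} {t} circ 0<d d<n = begin
  firstRow t (n ∸ d)              ≡⟨ cong (firstRow t) ∣v-0∣≡n∸d ⟨
  firstRow t ∣ toℕ v - 0 ∣         ≡⟨ toeplitzAdj-offDiagonal {t = t} {i = v} {j = fzero} v≢0 ⟨
  toeplitzAdj n k t v fzero       ≡⟨ circulant-diffMod-invariant circ {v} {fzero} {fzero} {u} diffMod-v0≡diffMod-0u ⟩
  toeplitzAdj n k t fzero u       ≡⟨ toeplitzAdj-offDiagonal {t = t} {i = fzero} {j = u} 0≢u ⟩
  firstRow t (toℕ u)              ≡⟨ cong (firstRow t) u≡d ⟩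
  firstRow t d                    ∎
  where
  n∸d<n : n ∸ d < n
  n∸d<n = ∸-monoʳ-< 0<d (<⇒≤ d<n)
  u v : Fin n
  u = fromℕ< d<n
  v = fromℕ< n∸d<n
  u≡d : toℕ u ≡ d
  u≡d = toℕ-fromℕ< d<n
  v≡n∸d : toℕ v ≡ n ∸ d
  v≡n∸d = toℕ-fromℕ< n∸d<n
  ∣v-0∣≡n∸d : ∣ toℕ v - 0 ∣ ≡ n ∸ d
  ∣v-0∣≡n∸d = trans (∣-∣-identityʳ (toℕ v)) v≡n∸d
  v≢0 : toℕ v ≢ 0
  v≢0 v≡0 = <-irrefl (trans (sym v≡0) v≡n∸d) (m<n⇒0<n∸m d<n)
  0≢u : 0 ≢ toℕ u
  0≢u 0≡u = <-irrefl (trans 0≡u u≡d) 0<d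
  diffMod-v0≡diffMod-0u : diffMod n v fzero ≡ diffMod n fzero u
  diffMod-v0≡diffMod-0u = begin
    diffMod n v fzero   ≡⟨ diffMod-≥ n≮0 ⟩
    ∣ toℕ v - 0 ∣        ≡⟨ ∣v-0∣≡n∸d ⟩
    n ∸ d               ≡⟨ cong (n ∸_) u≡d ⟨
    n ∸ toℕ u           ≡⟨ diffMod-< (subst (0 <_) (sym u≡d) 0<d) ⟨
    diffMod n fzero u   ∎

circulant⇒complementClosed : {t : Fin k → ℕ} → (∀ l → 1 ≤ t l) → (∀ l → t l < n) →
  IsCirculantToeplitz n k t → ∀ a → InImage t (n ∸ t a)
circulant⇒complementClosed {n = n} {t = t} t≥1 t<n circ a =
  indicator≡1⇒ (inImage? t (n ∸ t a)) (begin
    firstRow t (n ∸ t a) ≡⟨ circulant⇒firstRow-complement {t = t} circ (t≥1 a) (t<n a) ⟩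
    firstRow t (t a)     ≡⟨ indicator-yes (inImage? t (t a)) (a , refl) ⟩
    1                    ∎)

mirrorSymmetric⇒circulant : {t : Fin k → ℕ} → (∀ l → 1 ≤ t l) → MirrorSymmetric n t →
  IsCirculantToeplitz n k t
mirrorSymmetric⇒circulant {k} {n} {t} t≥1 t-sym = firstRow t , firstRow-zero , firstRow-symmetric , entries
  where
  firstRow-zero : firstRow t 0 ≡ 0
  firstRow-zero = indicator-no (inImage? t 0) (λ (l , tl≡0) → <-irrefl (sym tl≡0) (t≥1 l))

  firstRow-symmetric : ∀ d → 1 ≤ d → d ≤ n / 2 →
    (firstRow t d ≡ 0 ⊎ firstRow t d ≡ 1) × firstRow t d ≡ firstRow t (n ∸ d)
  firstRow-symmetric d _ d≤n/2 =
    indicator-01 (inImage? t d) , firstRow-complement t-sym (≤-trans d≤n/2 (m/n≤m n 2))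

  entries : ∀ i j → toeplitzAdj n k t i j ≡ firstRow t (diffMod n i j)
  entries i j with toℕ i ≟ toℕ j | toℕ i <? toℕ j
  ... | yes i≡j | _ = begin
    toeplitzAdj n k t i j        ≡⟨ toeplitzAdj-diagonal {t = t} i≡j ⟩
    0                            ≡⟨ firstRow-zero ⟨
    firstRow t 0                 ≡⟨ cong (firstRow t) (m≡n⇒∣m-n∣≡0 i≡j) ⟨
    firstRow t ∣ toℕ i - toℕ j ∣ ≡⟨ cong (firstRow t) (diffMod-≥ (<-irrefl i≡j)) ⟨
    firstRow t (diffMod n i j)   ∎
  ... | no i≢j | yes i<j = begin
    toeplitzAdj n k t i j              ≡⟨ toeplitzAdj-offDiagonal {t = t} i≢j ⟩
    firstRow t ∣ toℕ i - toℕ j ∣       ≡⟨ firstRow-complement t-sym (∣toℕ-toℕ∣≤ i j) ⟩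
    firstRow t (n ∸ ∣ toℕ i - toℕ j ∣) ≡⟨ cong (firstRow t) (diffMod-< i<j) ⟨
    firstRow t (diffMod n i j)         ∎
  ... | no i≢j | no i≮j = begin
    toeplitzAdj n k t i j        ≡⟨ toeplitzAdj-offDiagonal {t = t} i≢j ⟩
    firstRow t ∣ toℕ i - toℕ j ∣ ≡⟨ cong (firstRow t) (diffMod-≥ i≮j) ⟨
    firstRow t (diffMod n i j)   ∎

lemma24 : (n k : ℕ) (t : Fin k → ℕ) → ValidParams n k t →
    (IsCirculantToeplitz n k t → (∀ (i : Fin k) → t (opposite i) ≡ n ∸ t i)) ×
    ((∀ (i : Fin k) → t (opposite i) ≡ n ∸ t i) → IsCirculantToeplitz n k t)
lemma24 n k t (t≥1 , t↑ , t<n) =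
  (λ circ → complementClosed⇒mirrorSymmetric t↑ (λ l → <⇒≤ (t<n l))
              (circulant⇒complementClosed t≥1 t<n circ)) ,
  mirrorSymmetric⇒circulant t≥1
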